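{- Let $T$ be a paving tournament and let $\sigma$ be a paving ordering of $T$. If $B_\sigma(T)$ has $m$ edges, then $\nu(T)\ge \frac{m}{4}$. Furthermore, if $T$ is $\Delta(1,2,2)$-free, then $\nu(T)\ge\frac{m}{3}$.
   Context: Tournaments are finite; $X\Rightarrow Y$: all edges between disjoint $X,Y$ go from $X$ to $Y$. $\Delta(1,2,2)$: vertices $x,y_1,y_2,z_1,z_2$ with $x\Rightarrow\{y_1,y_2\}\Rightarrow\{z_1,z_2\}\Rightarrow x$ and edges $y_1y_2,z_1z_2$; $T$ is $\Delta(1,2,2)$-free if no induced subtournament is isomorphic to it. For an ordering $\sigma=(v_1,\dots,v_n)$, $B_\sigma(T)$ is the undirected graph on $V(T)$ with edges $v_iv_j$ for $i>j$ and $v_iv_j\in E(T)$. A paving ordering is an ordering $\sigma$ with $v_i,v_{i+1}$ nonadjacent in $B_\sigma(T)$ for all $i\in[n-1]$ and each $v_i$ having at most one $B_\sigma(T)$-neighbour in $\{v_s:s<i\}$ and at most one in $\{v_t:t>i\}$; a paving tournament admits one. $\nu(T)$ is the maximum number of pairwise vertex-disjoint cyclic triangles in $T$. -}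

module Defs where

open import Data.Nat using (ℕ; _<_; _<ᵇ_)
open import Data.Bool using (Bool; true; false; _∧_; if_then_else_)
open import Data.Fin using (Fin; toℕ; suc; inject₁)
open import Data.Fin.Permutation using (Permutation′; _⟨$⟩ʳ_)
open import Data.List using (List; []; _∷_; map; allFin; concatMap; length)
open import Data.Nat.ListAction using (sum)
open import Data.List.Relation.Unary.All using (All)
open import Data.List.Relation.Unary.Unique.Propositional using (Unique)
open import Data.Product using (_×_; _,_; Σ; ∃)
open import Relation.Binary.PropositionalEquality using (_≡_; _≢_)
open import Relation.Nullary using (¬_)

record Tournament (n : ℕ) : Set where
  field
    E : Fin n → Fin n → Bool
    irrefl : ∀ u → E u u ≡ false
    asym : ∀ u v → u ≢ v → E u v ≡ true → E v u ≡ false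
    complete : ∀ u v → u ≢ v → E u v ≡ false → E v u ≡ true
open Tournament public

-- An ordering σ = (v_0,…,v_{n-1}) with v_i = σ ⟨$⟩ʳ i.
Ordering : ℕ → Set
Ordering n = Permutation′ n

-- Backward edge: positions i > j with v_i → v_j; these are the edges of B_σ(T).
back : ∀ {n} → Tournament n → Ordering n → Fin n → Fin n → Bool
back T σ i j = (toℕ j <ᵇ toℕ i) ∧ E T (σ ⟨$⟩ʳ i) (σ ⟨$⟩ʳ j)

numBackEdges : ∀ {n} → Tournament n → Ordering n → ℕ
numBackEdges {n} T σ =
  sum (map (λ i → sum (map (λ j → if back T σ i j then 1 else 0) (allFin n))) (allFin n))

record IsPaving {n : ℕ} (T : Tournament n) (σ : Ordering n) : Set where
  field
    -- v_i and v_{i+1} nonadjacent in B_σ(T), i.e. no edge v_{i+1} → v_i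
    consecutive : ∀ (i : Fin n) (j : Fin n) → toℕ j ≡ Data.Nat.suc (toℕ i) →
                  back T σ j i ≡ false
    earlierAtMostOne : ∀ (i s s′ : Fin n) → back T σ i s ≡ true → back T σ i s′ ≡ true → s ≡ s′
    laterAtMostOne : ∀ (i t t′ : Fin n) → back T σ t i ≡ true → back T σ t′ i ≡ true → t ≡ t′

IsPavingTournament : ∀ {n} → Tournament n → Set
IsPavingTournament T = Σ (Ordering _) (IsPaving T)

Triple : ℕ → Set
Triple n = Fin n × Fin n × Fin n

IsCyclicTriangle : ∀ {n} → Tournament n → Triple n → Set
IsCyclicTriangle T (a , b , c) = (E T a b ≡ true) × (E T b c ≡ true) × (E T c a ≡ true)

verts : ∀ {n} → List (Triple n) → List (Fin n)
verts = concatMap (λ { (a , b , c) → a ∷ b ∷ c ∷ [] })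

IsPacking : ∀ {n} → Tournament n → List (Triple n) → Set
IsPacking T ts = All (IsCyclicTriangle T) ts × Unique (verts ts)

-- ν(T) ≥ k  iff there is a packing of k cyclic triangles.
-- (ν(T) ≥ m/4 with ν integral is expressed as ∃ packing P, m ≤ 4·|P|.)

HasDelta122 : ∀ {n} → Tournament n → Set
HasDelta122 {n} T = ∃ λ (x : Fin n) → ∃ λ (y1 : Fin n) → ∃ λ (y2 : Fin n) →
  ∃ λ (z1 : Fin n) → ∃ λ (z2 : Fin n) →
  (E T x y1 ≡ true) × (E T x y2 ≡ true) ×
  (E T y1 z1 ≡ true) × (E T y1 z2 ≡ true) × (E T y2 z1 ≡ true) × (E T y2 z2 ≡ true) ×
  (E T z1 x ≡ true) × (E T z2 x ≡ true) ×
  (E T y1 y2 ≡ true) × (E T z1 z2 ≡ true)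

Delta122Free : ∀ {n} → Tournament n → Set
Delta122Free T = ¬ HasDelta122 T

{-# OPTIONS --safe #-}
module Submission where

-- A back edge (x , y) of B_σ(T) together with any vertex m strictly between x and y
-- spans the cyclic triangle (x , m , y), and since consecutive vertices are never
-- B-adjacent, every back edge has such an m. Run the greedy algorithm on a shrinking
-- set S of positions: among the back edges of S that still have a vertex of S
-- strictly inside ("long" edges, counted by their right ends), take the one (a , c)
-- with leftmost right end, a middle vertex b, and delete a, b, c. Because every
-- vertex has at most one B-neighbour on each side, this destroys at most four long
-- edges: (a , c), the edges leaving b and c, and one edge (x , s) whose inner
-- vertices were all deleted, which must jump over c onto the successor s of c.
-- In the Δ(1,2,2)-free case such an arch is paid for: if a < x, then an edge
-- leaving c would form a Δ(1,2,2) with (a , c) and (x , s); if x < a, deleting the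
-- triangle (x , a , s) instead loses at most three long edges, by the same argument.

open import Defs
open import Level using (Level; 0ℓ)
open import Function using (_∘_; _on_)
open import Function.Bundles using (Equivalence)
open import Data.Bool using (true; false; _∧_; if_then_else_)
open import Data.Bool.Properties using (∧-conicalˡ; ∧-conicalʳ; T-≡; ¬-not)
import Data.Bool.Properties as Bool
open import Data.Nat using (ℕ; zero; suc; _+_; _*_; _≤_; z≤n; s≤s)
import Data.Nat as ℕ
open import Data.Nat.Properties
  using ( ≤-refl; ≤-reflexive; ≤-trans; +-mono-≤; +-monoˡ-≤; +-monoʳ-≤; +-comm; +-suc; *-suc
        ; ≮⇒≥; <ᵇ⇒<; <⇒<ᵇ; n≮0; module ≤-Reasoning)
import Data.Nat.Properties as ℕ
import Data.Nat.Induction as ℕ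
open import Data.Nat.ListAction using (sum)
open import Data.Fin using (Fin; zero; suc; toℕ; fromℕ<; _<_)
open import Data.Fin.Properties
  using (_≟_; _<?_; <-cmp; <-trans; <⇒≢; any?; suc-injective; toℕ<n; toℕ-fromℕ<)
import Data.Fin.Induction as Fin
open import Data.Fin.Subset using (Subset; inside; outside; _∈_; _∉_; _∪_; _─_; ⁅_⁆; ∣_∣; ⊤)
open import Data.Fin.Subset.Properties
  using ( _∈?_; ∈⊤; x∈⁅x⁆; x∈⁅y⁆⇒x≡y; x∈p∪q⁺; x∈p∪q⁻; x∈p∧x∉q⇒x∈p─q; p─q⊆p; x∈p∩q⁺
        ; p∩q≢∅⇒∣p─q∣<∣p∣; p⊆q⇒∣p∣≤∣q∣; Empty-unique; ∣⊥∣≡0)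
open import Data.Fin.Permutation using (_⟨$⟩ʳ_; _⟨$⟩ˡ_; inverseˡ)
open import Data.Vec using ([]; _∷_; here; there)
open import Data.List using (List; []; _∷_; length; map; tabulate; allFin)
open import Data.List.Properties using (map-tabulate)
open import Data.List.Relation.Unary.All as All using (All; []; _∷_)
open import Data.List.Relation.Unary.AllPairs using ([]; _∷_)
open import Data.Product using (Σ; Σ-syntax; ∃; _×_; _,_; proj₁; proj₂)
open import Data.Empty using (⊥-elim)
open import Data.Sum as Sum using (_⊎_; inj₁; inj₂; fromInj₁)
open import Induction.WellFounded as WF using (Acc; acc; WfRec)
import Relation.Binary.Construct.On as On
open import Relation.Binary.Definitions using (tri<; tri≈; tri>)
open import Relation.Binary.PropositionalEquality
  using (_≡_; _≢_; refl; sym; trans; cong; subst; module ≡-Reasoning)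
open import Relation.Nullary using (¬_; Dec; yes; no; does; contradiction)
open import Relation.Nullary.Decidable using (_×-dec_; ¬?; decidable-stable)
open import Relation.Unary using (Pred; Decidable; _⊆_)
open import Relation.Unary.Properties using (_∪?_)

private
  variable
    ℓ : Level
    m : ℕ

⟦_⟧ : {P : Pred (Fin m) ℓ} → Decidable P → Subset m
⟦_⟧ {m = zero}  P? = []
⟦_⟧ {m = suc m} P? = does (P? zero) ∷ ⟦ P? ∘ suc ⟧

∈⟦⟧⁺ : {P : Pred (Fin m) ℓ} (P? : Decidable P) {x : Fin m} → P x → x ∈ ⟦ P? ⟧
∈⟦⟧⁺ P? {zero} Px with P? zero
... | yes _  = here
... | no ¬Px = contradiction Px ¬Px
∈⟦⟧⁺ P? {suc x} Px = there (∈⟦⟧⁺ (P? ∘ suc) Px)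

∈⟦⟧⁻ : {P : Pred (Fin m) ℓ} (P? : Decidable P) {x : Fin m} → x ∈ ⟦ P? ⟧ → P x
∈⟦⟧⁻ P? {zero} x∈ with P? zero | x∈
... | yes Px | _ = Px
∈⟦⟧⁻ P? {suc x} (there x∈) = ∈⟦⟧⁻ (P? ∘ suc) x∈

∣p∪q∣≤∣p∣+∣q∣ : (p q : Subset m) → ∣ p ∪ q ∣ ≤ ∣ p ∣ + ∣ q ∣
∣p∪q∣≤∣p∣+∣q∣ []            []            = z≤n
∣p∪q∣≤∣p∣+∣q∣ (inside  ∷ p) (outside ∷ q) = s≤s (∣p∪q∣≤∣p∣+∣q∣ p q)
∣p∪q∣≤∣p∣+∣q∣ (inside  ∷ p) (inside  ∷ q) =
  s≤s (≤-trans (∣p∪q∣≤∣p∣+∣q∣ p q) (+-monoʳ-≤ ∣ p ∣ (ℕ.n≤1+n ∣ q ∣)))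
∣p∪q∣≤∣p∣+∣q∣ (outside ∷ p) (inside  ∷ q) =
  ≤-trans (s≤s (∣p∪q∣≤∣p∣+∣q∣ p q)) (≤-reflexive (sym (+-suc ∣ p ∣ ∣ q ∣)))
∣p∪q∣≤∣p∣+∣q∣ (outside ∷ p) (outside ∷ q) = ∣p∪q∣≤∣p∣+∣q∣ p q

subsingleton⇒∣p∣≤1 : {p : Subset m} → (∀ {x y} → x ∈ p → y ∈ p → x ≡ y) → ∣ p ∣ ≤ 1
subsingleton⇒∣p∣≤1 {p = []} _ = z≤n
subsingleton⇒∣p∣≤1 {m = suc m} {p = inside ∷ p} unique =
  s≤s (≤-reflexive (trans (cong ∣_∣ (Empty-unique λ (_ , x∈p) → zero≢suc (unique here (there x∈p))))
                          (∣⊥∣≡0 m)))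
  where
  zero≢suc : {x : Fin m} → ¬ zero ≡ suc x
  zero≢suc ()
subsingleton⇒∣p∣≤1 {p = outside ∷ p} unique =
  subsingleton⇒∣p∣≤1 λ x∈p y∈p → suc-injective (unique (there x∈p) (there y∈p))

module _ {a b c x : Fin m} where

  x∈⁅a⁆∪⁅b⁆∪⁅c⁆⁺ : x ≡ a ⊎ x ≡ b ⊎ x ≡ c → x ∈ ⁅ a ⁆ ∪ ⁅ b ⁆ ∪ ⁅ c ⁆
  x∈⁅a⁆∪⁅b⁆∪⁅c⁆⁺ (inj₁ refl)        = x∈p∪q⁺ (inj₁ (x∈⁅x⁆ a))
  x∈⁅a⁆∪⁅b⁆∪⁅c⁆⁺ (inj₂ (inj₁ refl)) = x∈p∪q⁺ (inj₂ (x∈p∪q⁺ (inj₁ (x∈⁅x⁆ b))))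
  x∈⁅a⁆∪⁅b⁆∪⁅c⁆⁺ (inj₂ (inj₂ refl)) = x∈p∪q⁺ (inj₂ (x∈p∪q⁺ (inj₂ (x∈⁅x⁆ c))))

  x∈⁅a⁆∪⁅b⁆∪⁅c⁆⁻ : x ∈ ⁅ a ⁆ ∪ ⁅ b ⁆ ∪ ⁅ c ⁆ → x ≡ a ⊎ x ≡ b ⊎ x ≡ c
  x∈⁅a⁆∪⁅b⁆∪⁅c⁆⁻ x∈ =
    Sum.map (x∈⁅y⁆⇒x≡y a) (Sum.map (x∈⁅y⁆⇒x≡y b) (x∈⁅y⁆⇒x≡y c) ∘ x∈p∪q⁻ ⁅ b ⁆ ⁅ c ⁆)
      (x∈p∪q⁻ ⁅ a ⁆ (⁅ b ⁆ ∪ ⁅ c ⁆) x∈)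

x∈p─q⇒x∉q : {p q : Subset m} {x : Fin m} → x ∈ p ─ q → x ∉ q
x∈p─q⇒x∉q {p = inside ∷ p} {outside ∷ q} here       ()
x∈p─q⇒x∉q {p = _      ∷ p} {_       ∷ q} (there x∈) (there x∈q) = x∈p─q⇒x∉q x∈ x∈q

count : {P : Pred (Fin m) ℓ} → Decidable P → ℕ
count P? = ∣ ⟦ P? ⟧ ∣

count-mono : {P Q : Pred (Fin m) ℓ} (P? : Decidable P) (Q? : Decidable Q) →
             P ⊆ Q → count P? ≤ count Q?
count-mono P? Q? P⊆Q = p⊆q⇒∣p∣≤∣q∣ λ x∈ → ∈⟦⟧⁺ Q? (P⊆Q (∈⟦⟧⁻ P? x∈))

count-∪? : {P Q : Pred (Fin m) ℓ} (P? : Decidable P) (Q? : Decidable Q) {k l : ℕ} →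
           count P? ≤ k → count Q? ≤ l → count (P? ∪? Q?) ≤ k + l
count-∪? P? Q? P≤k Q≤l = begin
  count (P? ∪? Q?)     ≤⟨ p⊆q⇒∣p∣≤∣q∣ split ⟩
  ∣ ⟦ P? ⟧ ∪ ⟦ Q? ⟧ ∣  ≤⟨ ∣p∪q∣≤∣p∣+∣q∣ ⟦ P? ⟧ ⟦ Q? ⟧ ⟩
  count P? + count Q?  ≤⟨ +-mono-≤ P≤k Q≤l ⟩
  _                    ∎
  where
  open ≤-Reasoning
  split : ∀ {x} → x ∈ ⟦ P? ∪? Q? ⟧ → x ∈ ⟦ P? ⟧ ∪ ⟦ Q? ⟧
  split x∈ = x∈p∪q⁺ (Sum.map (∈⟦⟧⁺ P?) (∈⟦⟧⁺ Q?) (∈⟦⟧⁻ (P? ∪? Q?) x∈))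

count≤1 : {P : Pred (Fin m) ℓ} (P? : Decidable P) → (∀ {x y} → P x → P y → x ≡ y) → count P? ≤ 1
count≤1 P? unique = subsingleton⇒∣p∣≤1 λ x∈ y∈ → unique (∈⟦⟧⁻ P? x∈) (∈⟦⟧⁻ P? y∈)

count-∅ : {P : Pred (Fin m) ℓ} (P? : Decidable P) → (∀ x → ¬ P x) → count P? ≡ 0
count-∅ {m = m} P? ∄ = trans (cong ∣_∣ (Empty-unique λ (x , x∈) → ∄ x (∈⟦⟧⁻ P? x∈))) (∣⊥∣≡0 m)

count>0⇒∃ : {P : Pred (Fin m) ℓ} (P? : Decidable P) → 0 ℕ.< count P? → ∃ P
count>0⇒∃ P? 0<count =
  decidable-stable (any? P?) λ ∄ → n≮0 (subst (0 ℕ.<_) (count-∅ P? λ x Px → ∄ (x , Px)) 0<count)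

sum-tabulate≤count : {P : Pred (Fin m) ℓ} (f : Fin m → ℕ) (P? : Decidable P) →
                     (∀ i → f i ≤ 1) → (∀ i → 0 ℕ.< f i → P i) → sum (tabulate f) ≤ count P?
sum-tabulate≤count {m = zero}  f P? _   _     = z≤n
sum-tabulate≤count {m = suc m} f P? f≤1 f>0⇒P
  with P? zero | sum-tabulate≤count (f ∘ suc) (P? ∘ suc) (f≤1 ∘ suc) (f>0⇒P ∘ suc)
... | yes _  | rest = +-mono-≤ (f≤1 zero) rest
... | no ¬P0 | rest = +-mono-≤ (≮⇒≥ (¬P0 ∘ f>0⇒P zero)) rest

sum-map-allFin : (f : Fin m → ℕ) → sum (map f (allFin m)) ≡ sum (tabulate f)
sum-map-allFin f = cong sum (map-tabulate (λ i → i) f)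

indicator≤1 : ∀ b → (if b then 1 else 0) ≤ 1
indicator≤1 true  = ≤-refl
indicator≤1 false = z≤n

indicator>0 : ∀ b → 0 ℕ.< (if b then 1 else 0) → b ≡ true
indicator>0 true _ = refl

least-witness : {P : Pred (Fin m) ℓ} (P? : Decidable P) → ∃ P →
                ∃ λ i → P i × (∀ {j} → P j → ¬ j < i)
least-witness {P = P} P? (i , Pi) = go (Fin.<-wellFounded i) Pi
  where
  go : ∀ {i} → Acc _<_ i → P i → ∃ λ i → P i × (∀ {j} → P j → ¬ j < i)
  go {i} (acc smaller) Pi with any? (λ j → P? j ×-dec j <? i)
  ... | yes (j , Pj , j<i) = go (smaller j<i) Pj
  ... | no ∄               = i , Pi , λ Pj j<i → ∄ (_ , Pj , j<i)

module Paving {n : ℕ} (T : Tournament n) (σ : Ordering n) (paving : IsPaving T σ) where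
  open IsPaving paving

  private
    variable
      x y z : Fin n
      S S′ : Subset n
      K : ℕ

  vertex : Fin n → Fin n
  vertex i = σ ⟨$⟩ʳ i

  position : Fin n → Fin n
  position u = σ ⟨$⟩ˡ u

  vertex-injective : vertex x ≡ vertex y → x ≡ y
  vertex-injective {x} {y} eq = begin
    x                    ≡⟨ inverseˡ σ ⟨
    position (vertex x)  ≡⟨ cong position eq ⟩
    position (vertex y)  ≡⟨ inverseˡ σ ⟩
    y                    ∎
    where open ≡-Reasoning

  _⟶_ : Fin n → Fin n → Set
  x ⟶ y = E T (vertex x) (vertex y) ≡ true

  Back : Fin n → Fin n → Set
  Back x y = back T σ y x ≡ true

  Back? : ∀ x y → Dec (Back x y)
  Back? x y = back T σ y x Bool.≟ true

  Back⇒< : Back x y → x < y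
  Back⇒< {x} {y} xy = <ᵇ⇒< (toℕ x) (toℕ y) (Equivalence.from T-≡ (∧-conicalˡ _ _ xy))

  Back⇒⟵ : Back x y → y ⟶ x
  Back⇒⟵ {x} {y} xy = ∧-conicalʳ (toℕ x ℕ.<ᵇ toℕ y) _ xy

  forward : x < y → ¬ Back x y → x ⟶ y
  forward {x} {y} x<y ¬xy = complete T (vertex y) (vertex x) (<⇒≢ x<y ∘ sym ∘ vertex-injective) y↛x
    where
    y↛x : E T (vertex y) (vertex x) ≡ false
    y↛x = begin
      E T (vertex y) (vertex x)  ≡⟨ cong (_∧ E T (vertex y) (vertex x)) (Equivalence.to T-≡ (<⇒<ᵇ x<y)) ⟨
      back T σ y x               ≡⟨ ¬-not ¬xy ⟩
      false                      ∎
      where open ≡-Reasoning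

  Back-uniqueˡ : Back x z → Back y z → x ≡ y
  Back-uniqueˡ {x} {z} {y} = earlierAtMostOne z x y

  Back-uniqueʳ : Back x y → Back x z → y ≡ z
  Back-uniqueʳ {x} {y} {z} = laterAtMostOne x y z

  forwardʳ : x < y → Back x z → y ≢ z → x ⟶ y
  forwardʳ x<y xz y≢z = forward x<y λ xy → y≢z (Back-uniqueʳ xy xz)

  forwardˡ : x < y → Back z y → x ≢ z → x ⟶ y
  forwardˡ x<y zy x≢z = forward x<y λ xy → x≢z (Back-uniqueˡ xy zy)

  cyclic : ∀ {a b c} → Back a c → a < b → b < c → IsCyclicTriangle T (vertex a , vertex b , vertex c)
  cyclic ac a<b b<c = forwardʳ a<b ac (<⇒≢ b<c) , forwardˡ b<c ac (<⇒≢ a<b ∘ sym) , Back⇒⟵ ac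

  Δ122 : ∀ {a b c d e} → a < b → b < c → c < d → d < e →
         Back a c → Back b d → Back c e → HasDelta122 T
  Δ122 {a} {b} {c} {d} {e} a<b b<c c<d d<e ac bd ce =
    vertex c , vertex a , vertex d , vertex b , vertex e ,
    Back⇒⟵ ac , forwardʳ c<d ce (<⇒≢ d<e) ,
    forwardʳ a<b ac (<⇒≢ b<c) , forwardʳ (<-trans a<d d<e) ac (<⇒≢ (<-trans c<d d<e) ∘ sym) ,
    Back⇒⟵ bd , forwardˡ d<e ce (<⇒≢ c<d ∘ sym) ,
    forwardʳ b<c bd (<⇒≢ c<d) , Back⇒⟵ ce ,
    forwardʳ a<d ac (<⇒≢ c<d ∘ sym) , forwardʳ (<-trans b<d d<e) bd (<⇒≢ d<e ∘ sym)
    where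
    b<d = <-trans b<c c<d
    a<d = <-trans a<b b<d

  Between : Subset n → Fin n → Fin n → Set
  Between S x y = ∃ λ m → m ∈ S × x < m × m < y

  Between? : ∀ S x y → Dec (Between S x y)
  Between? S x y = any? λ m → m ∈? S ×-dec x <? m ×-dec m <? y

  Long : Subset n → Fin n → Set
  Long S y = y ∈ S × ∃ λ x → x ∈ S × Back x y × Between S x y

  Long? : ∀ S → Decidable (Long S)
  Long? S y = y ∈? S ×-dec any? λ x → x ∈? S ×-dec Back? x y ×-dec Between? S x y

  long : Subset n → ℕ
  long S = count (Long? S)

  Next : Subset n → Fin n → Fin n → Set
  Next S x y = y ∈ S × x < y × ¬ Between S x y

  Next? : ∀ S x → Decidable (Next S x)
  Next? S x y = y ∈? S ×-dec x <? y ×-dec ¬? (Between? S x y)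

  Next⇒≮ : Next S x y → z ∈ S → x < z → ¬ z < y
  Next⇒≮ (_ , _ , ¬between) z∈S x<z z<y = ¬between (_ , z∈S , x<z , z<y)

  Next⇒< : Next S x y → z ∈ S → x < z → z ≢ y → y < z
  Next⇒< {y = y} {z = z} next z∈S x<z z≢y with <-cmp y z
  ... | tri< y<z _ _ = y<z
  ... | tri≈ _ y≡z _ = contradiction (sym y≡z) z≢y
  ... | tri> _ _ z<y = contradiction z<y (Next⇒≮ next z∈S x<z)

  Next-unique : Next S x y → Next S x z → y ≡ z
  Next-unique {y = y} {z = z} ny@(y∈S , x<y , _) nz@(z∈S , x<z , _) =
    decidable-stable (y ≟ z) λ y≢z → Next⇒≮ nz y∈S x<y (Next⇒< ny z∈S x<z (y≢z ∘ sym))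

  record LongTriangle (S : Subset n) : Set where
    field
      {a b c} : Fin n
      a∈S : a ∈ S
      b∈S : b ∈ S
      c∈S : c ∈ S
      ac  : Back a c
      a<b : a < b
      b<c : b < c

    a<c : a < c
    a<c = <-trans a<b b<c

  triangleAt : Long S z → LongTriangle S
  triangleAt (c∈S , a , a∈S , ac , b , b∈S , a<b , b<c) = record
    { a∈S = a∈S ; b∈S = b∈S ; c∈S = c∈S ; ac = ac ; a<b = a<b ; b<c = b<c }

  corners : LongTriangle S → Subset n
  corners t = ⁅ a ⁆ ∪ ⁅ b ⁆ ∪ ⁅ c ⁆
    where open LongTriangle t

  corners-shrink : (t : LongTriangle S) → ∣ S ─ corners t ∣ ℕ.< ∣ S ∣
  corners-shrink {S} t =
    p∩q≢∅⇒∣p─q∣<∣p∣ S (corners t) (a , x∈p∩q⁺ (a∈S , x∈⁅a⁆∪⁅b⁆∪⁅c⁆⁺ (inj₁ refl)))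
    where open LongTriangle t

  Packing : ℕ → Subset n → Set
  Packing K S = Σ[ P ∈ List (Triple n) ]
    IsPacking T P × All (λ u → position u ∈ S) (verts P) × long S ≤ K * length P

  extend : (t : LongTriangle S) → long S ≤ long (S ─ corners t) + K →
           Packing K (S ─ corners t) → Packing K S
  extend {S} {K} t cost (P , (cyclics , distinct) , inS , bound) =
    (vertex a , vertex b , vertex c) ∷ P ,
    ( cyclic ac a<b b<c ∷ cyclics
    , ( vertex-≢ (<⇒≢ a<b) ∷ vertex-≢ (<⇒≢ a<c) ∷ fresh (inj₁ refl))
      ∷ (vertex-≢ (<⇒≢ b<c) ∷ fresh (inj₂ (inj₁ refl)))
      ∷ fresh (inj₂ (inj₂ refl))
      ∷ distinct) ,
    placed a∈S ∷ placed b∈S ∷ placed c∈S ∷ All.map (p─q⊆p S (corners t)) inS ,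
    bound′
    where
    open LongTriangle t

    vertex-≢ : x ≢ y → vertex x ≢ vertex y
    vertex-≢ x≢y = x≢y ∘ vertex-injective

    placed : x ∈ S → position (vertex x) ∈ S
    placed = subst (_∈ S) (sym (inverseˡ σ))

    fresh : x ≡ a ⊎ x ≡ b ⊎ x ≡ c → All (vertex x ≢_) (verts P)
    fresh {x} x∈ =
      All.map (λ u∈ vx≡u → x∈p─q⇒x∉q u∈ (subst (_∈ corners t) (x≡position vx≡u) x∈corners)) inS
      where
      x∈corners : x ∈ corners t
      x∈corners = x∈⁅a⁆∪⁅b⁆∪⁅c⁆⁺ x∈
      x≡position : ∀ {u} → vertex x ≡ u → x ≡ position u
      x≡position vx≡u = trans (sym (inverseˡ σ)) (cong position vx≡u)

    bound′ : long S ≤ K * suc (length P)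
    bound′ = begin
      long S                    ≤⟨ cost ⟩
      long (S ─ corners t) + K  ≤⟨ +-monoˡ-≤ K bound ⟩
      K * length P + K          ≡⟨ +-comm (K * length P) K ⟩
      K + K * length P          ≡⟨ *-suc K (length P) ⟨
      K * suc (length P)        ∎
      where open ≤-Reasoning

  Minimal : LongTriangle S → Set
  Minimal {S} t = ∀ {y} → Long S y → ¬ y < LongTriangle.c t

  CheapTriangle : ℕ → Subset n → Set
  CheapTriangle K S = Σ[ t ∈ LongTriangle S ] long S ≤ long (S ─ corners t) + K

  greedy : (∀ {S} (t : LongTriangle S) → Minimal t → CheapTriangle K S) → ∀ S → Packing K S
  greedy {K} choose = WF.All.wfRec (On.wellFounded ∣_∣ ℕ.<-wellFounded) _ (Packing K) step
    where
    step : ∀ S → WfRec (ℕ._<_ on ∣_∣) (Packing K) S → Packing K S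
    step S smaller with any? (Long? S)
    ... | no ∄ = [] , ([] , []) , [] , ≤-trans (≤-reflexive (count-∅ (Long? S) λ y l → ∄ (y , l))) z≤n
    ... | yes ∃long with least-witness (Long? S) ∃long
    ...   | (_ , l , minimal) with choose (triangleAt l) minimal
    ...     | (t , cost) = extend t cost (smaller (corners-shrink t))

  cost≤ : {Q : Pred (Fin n) 0ℓ} (Q? : Decidable Q) → count Q? ≤ K →
          (∀ {y} → Long S y → Long S′ y ⊎ Q y) → long S ≤ long S′ + K
  cost≤ {K = K} {S = S} {S′ = S′} Q? Q≤K cover = begin
    long S                   ≤⟨ count-mono (Long? S) (Long? S′ ∪? Q?) cover ⟩
    count (Long? S′ ∪? Q?)   ≤⟨ count-∪? (Long? S′) Q? ≤-refl Q≤K ⟩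
    long S′ + K              ∎
    where open ≤-Reasoning

  count-≡≤1 : count (_≟ x) ≤ 1
  count-≡≤1 {x} = count≤1 (_≟ x) λ y≡x z≡x → trans y≡x (sym z≡x)

  count-Back≤1 : count (Back? x) ≤ 1
  count-Back≤1 {x} = count≤1 (Back? x) Back-uniqueʳ

  count-Next≤1 : count (Next? S x) ≤ 1
  count-Next≤1 {S} {x} = count≤1 (Next? S x) Next-unique

  data Fate (S D : Subset n) (y : Fin n) : Set where
    survives    : Long (S ─ D) y → Fate S D y
    deleted     : y ∈ D → Fate S D y
    leftDeleted : ∀ {x} → Back x y → x ∈ D → Fate S D y
    gapDeleted  : ∀ {x} → Back x y → x ∈ S → x ∉ D → Between S x y →
                  (∀ {m} → m ∈ S → x < m → m < y → m ∈ D) → Fate S D y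

  fate : ∀ D → Long S y → Fate S D y
  fate {S} {y} D (y∈S , x , x∈S , xy , between) with y ∈? D | x ∈? D | Between? (S ─ D) x y
  ... | yes y∈D | _       | _            = deleted y∈D
  ... | no _    | yes x∈D | _            = leftDeleted xy x∈D
  ... | no y∉D  | no x∉D  | yes between′ =
    survives (x∈p∧x∉q⇒x∈p─q y∈S y∉D , x , x∈p∧x∉q⇒x∈p─q x∈S x∉D , xy , between′)
  ... | no _    | no x∉D  | no ¬between′ = gapDeleted xy x∈S x∉D between λ m∈S x<m m<y →
    decidable-stable (_ ∈? D) λ m∉D → ¬between′ (_ , x∈p∧x∉q⇒x∈p─q m∈S m∉D , x<m , m<y)

  module LeftmostLongTriangle {S : Subset n} (t : LongTriangle S) (minimal : Minimal t) where
    open LongTriangle t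

    D : Subset n
    D = corners t

    D≤c : y ∈ D → toℕ y ≤ toℕ c
    D≤c y∈D with x∈⁅a⁆∪⁅b⁆∪⁅c⁆⁻ y∈D
    ... | inj₁ refl        = ℕ.<⇒≤ a<c
    ... | inj₂ (inj₁ refl) = ℕ.<⇒≤ b<c
    ... | inj₂ (inj₂ refl) = ℕ.≤-refl

    c<long : Long S y → y ≢ c → c < y
    c<long {y} l y≢c with <-cmp c y
    ... | tri< c<y _ _ = c<y
    ... | tri≈ _ c≡y _ = contradiction (sym c≡y) y≢c
    ... | tri> _ _ y<c = contradiction y<c (minimal l)

    deleted⇒≡c : Long S y → y ∈ D → y ≡ c
    deleted⇒≡c l y∈D with x∈⁅a⁆∪⁅b⁆∪⁅c⁆⁻ y∈D
    ... | inj₁ refl        = contradiction a<c (minimal l)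
    ... | inj₂ (inj₁ refl) = contradiction b<c (minimal l)
    ... | inj₂ (inj₂ y≡c)  = y≡c

    Arch : Fin n → Set
    Arch y = Next S c y × ∃ λ x → x ∈ S × x ∉ D × x < c × Back x y

    Arch? : Decidable Arch
    Arch? y = Next? S c y ×-dec any? λ x → x ∈? S ×-dec ¬? (x ∈? D) ×-dec x <? c ×-dec Back? x y

    gap⇒Arch : Long S y → Back x y → x ∈ S → x ∉ D → Between S x y →
               (∀ {m} → m ∈ S → x < m → m < y → m ∈ D) → Arch y
    gap⇒Arch {y} {x} l@(y∈S , _) xy x∈S x∉D (m , m∈S , x<m , m<y) gap =
      (y∈S , c<y , ¬between) , x , x∈S , x∉D , x<c , xy
      where
      c<y : c < y
      c<y = c<long l λ y≡c → x∉D (x∈⁅a⁆∪⁅b⁆∪⁅c⁆⁺ (inj₁ (Back-uniqueˡ (subst (Back x) y≡c xy) ac)))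
      x<c : x < c
      x<c = ℕ.<-≤-trans x<m (D≤c (gap m∈S x<m m<y))
      ¬between : ¬ Between S c y
      ¬between (m′ , m′∈S , c<m′ , m′<y) = ℕ.<⇒≱ c<m′ (D≤c (gap m′∈S (<-trans x<c c<m′) m′<y))

    lost : Long S y → Long (S ─ D) y ⊎ y ≡ c ⊎ Back b y ⊎ Back c y ⊎ Arch y
    lost l with fate D l
    ... | survives l′                       = inj₁ l′
    ... | deleted y∈D                       = inj₂ (inj₁ (deleted⇒≡c l y∈D))
    ... | gapDeleted xy x∈S x∉D between gap =
      inj₂ (inj₂ (inj₂ (inj₂ (gap⇒Arch l xy x∈S x∉D between gap))))
    ... | leftDeleted xy x∈D with x∈⁅a⁆∪⁅b⁆∪⁅c⁆⁻ x∈D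
    ...   | inj₁ refl        = inj₂ (inj₁ (Back-uniqueʳ xy ac))
    ...   | inj₂ (inj₁ refl) = inj₂ (inj₂ (inj₁ xy))
    ...   | inj₂ (inj₂ refl) = inj₂ (inj₂ (inj₂ (inj₁ xy)))

    cost≤4 : long S ≤ long (S ─ D) + 4
    cost≤4 =
      cost≤ ((_≟ c) ∪? Back? b ∪? Back? c ∪? Next? S c)
            (count-∪? (_≟ c) _ count-≡≤1
              (count-∪? (Back? b) _ count-Back≤1 (count-∪? (Back? c) _ count-Back≤1 count-Next≤1)))
            cover
      where
      cover : Long S y → Long (S ─ D) y ⊎ y ≡ c ⊎ Back b y ⊎ Back c y ⊎ Next S c y
      cover l = Sum.map₂ (Sum.map₂ (Sum.map₂ (Sum.map₂ proj₁))) (lost l)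

    cost≤3-unarched : (∀ y → ¬ Arch y) → long S ≤ long (S ─ D) + 3
    cost≤3-unarched ∄ =
      cost≤ ((_≟ c) ∪? Back? b ∪? Back? c)
            (count-∪? (_≟ c) _ count-≡≤1 (count-∪? (Back? b) _ count-Back≤1 count-Back≤1))
            cover
      where
      cover : Long S y → Long (S ─ D) y ⊎ y ≡ c ⊎ Back b y ⊎ Back c y
      cover l = Sum.map₂ (Sum.map₂ (Sum.map₂ (fromInj₁ λ arch → contradiction arch (∄ _)))) (lost l)

    module Arched (free : Delta122Free T) {x s} (next : Next S c s) (x∈S : x ∈ S) (x<c : x < c)
                  (xs : Back x s) where
      s∈S : s ∈ S
      s∈S = proj₁ next

      c<s : c < s
      c<s = proj₁ (proj₂ next)

      cost≤3-nested : a < x → long S ≤ long (S ─ D) + 3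
      cost≤3-nested a<x =
        cost≤ ((_≟ c) ∪? Back? b ∪? (_≟ s))
              (count-∪? (_≟ c) _ count-≡≤1 (count-∪? (Back? b) _ count-Back≤1 count-≡≤1))
              cover
        where
        Next-unique′ : Next S c y → y ≡ s
        Next-unique′ next′ = Next-unique next′ next

        ¬Back-c : Long S y → ¬ Back c y
        ¬Back-c (y∈S , _) cy = free (Δ122 a<x x<c c<s s<y ac xs cy)
          where
          s<y = Next⇒< next y∈S (Back⇒< cy) λ y≡s → <⇒≢ x<c (Back-uniqueˡ xs (subst (Back c) y≡s cy))

        cover : Long S y → Long (S ─ D) y ⊎ y ≡ c ⊎ Back b y ⊎ y ≡ s
        cover l = Sum.map₂ (Sum.map₂ (Sum.map₂ Sum.[ ⊥-elim ∘ ¬Back-c l , Next-unique′ ∘ proj₁ ]))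
                           (lost l)

      module _ (x<a : x < a) where
        shifted : LongTriangle S
        shifted = record
          { a∈S = x∈S ; b∈S = a∈S ; c∈S = s∈S ; ac = xs ; a<b = x<a ; b<c = <-trans a<c c<s }

        D′ : Subset n
        D′ = corners shifted

        D′-split : y ∈ D′ → y < c ⊎ y ≡ s
        D′-split y∈D′ with x∈⁅a⁆∪⁅b⁆∪⁅c⁆⁻ y∈D′
        ... | inj₁ refl        = inj₁ x<c
        ... | inj₂ (inj₁ refl) = inj₁ a<c
        ... | inj₂ (inj₂ y≡s)  = inj₂ y≡s

        c∉D′ : c ∉ D′
        c∉D′ c∈D′ with D′-split c∈D′
        ... | inj₁ c<c = ℕ.<-irrefl refl c<c
        ... | inj₂ c≡s = <⇒≢ c<s c≡s

        D′-above-c : y ∈ D′ → c < y → y ≡ s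
        D′-above-c y∈D′ c<y with D′-split y∈D′
        ... | inj₁ y<c = contradiction y<c (ℕ.<-asym c<y)
        ... | inj₂ y≡s = y≡s

        gap⇒shiftedArch : Long S y → Back z y → z ∈ S → z ∉ D′ → Between S z y →
                          (∀ {m} → m ∈ S → z < m → m < y → m ∈ D′) → Back c y × Next S s y
        gap⇒shiftedArch {y} {z} l@(y∈S , _) zy z∈S z∉D′ (m , m∈S , z<m , m<y) gap with <-cmp z c
        ... | tri< z<c _ _ = contradiction (gap c∈S z<c c<y) c∉D′
          where
          c<y = c<long l λ y≡c →
            z∉D′ (x∈⁅a⁆∪⁅b⁆∪⁅c⁆⁺ (inj₂ (inj₁ (Back-uniqueˡ (subst (Back z) y≡c zy) ac))))
        ... | tri> _ _ c<z =
          contradiction (subst (z <_) (D′-above-c (gap m∈S z<m m<y) (<-trans c<z z<m)) z<m)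
                        (Next⇒≮ next z∈S c<z)
        ... | tri≈ _ refl _ = zy , y∈S , s<y , ¬between
          where
          s<y : s < y
          s<y = subst (_< y) (D′-above-c (gap m∈S z<m m<y) z<m) m<y
          ¬between : ¬ Between S s y
          ¬between (m′ , m′∈S , s<m′ , m′<y) =
            <⇒≢ s<m′ (sym (D′-above-c (gap m′∈S (<-trans c<s s<m′) m′<y) (<-trans c<s s<m′)))

        lost-shifted : Long S y → Long (S ─ D′) y ⊎ y ≡ s ⊎ y ≡ c ⊎ Back s y ⊎ (Back c y × Next S s y)
        lost-shifted l with fate D′ l
        ... | survives l′                        = inj₁ l′
        ... | gapDeleted zy z∈S z∉D′ between gap =
          inj₂ (inj₂ (inj₂ (inj₂ (gap⇒shiftedArch l zy z∈S z∉D′ between gap))))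
        ... | deleted y∈D′ with D′-split y∈D′
        ...   | inj₁ y<c = contradiction y<c (minimal l)
        ...   | inj₂ y≡s = inj₂ (inj₁ y≡s)
        lost-shifted l | leftDeleted zy z∈D′ with x∈⁅a⁆∪⁅b⁆∪⁅c⁆⁻ z∈D′
        ...   | inj₁ refl        = inj₂ (inj₁ (Back-uniqueʳ zy xs))
        ...   | inj₂ (inj₁ refl) = inj₂ (inj₂ (inj₁ (Back-uniqueʳ zy ac)))
        ...   | inj₂ (inj₂ refl) = inj₂ (inj₂ (inj₂ (inj₁ zy)))

        cost≤3-shifted : long S ≤ long (S ─ D′) + 3
        cost≤3-shifted with any? (λ u → u ∈? S ×-dec Back? s u)
        ... | yes (u , u∈S , su) =
          cost≤ ((_≟ s) ∪? (_≟ c) ∪? Back? s)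
                (count-∪? (_≟ s) _ count-≡≤1 (count-∪? (_≟ c) _ count-≡≤1 count-Back≤1))
                cover
          where
          ¬shiftedArch : ¬ (Back c y × Next S s y)
          ¬shiftedArch {y} (cy , next′@(_ , s<y , _)) = free (Δ122 x<c c<s s<y y<u xs cy su)
            where
            y<u : y < u
            y<u = Next⇒< next′ u∈S (Back⇒< su) λ u≡y →
              <⇒≢ c<s (sym (Back-uniqueˡ su (subst (Back c) (sym u≡y) cy)))

          cover : Long S y → Long (S ─ D′) y ⊎ y ≡ s ⊎ y ≡ c ⊎ Back s y
          cover l = Sum.map₂ (Sum.map₂ (Sum.map₂ (fromInj₁ (⊥-elim ∘ ¬shiftedArch)))) (lost-shifted l)
        ... | no ∄ =
          cost≤ ((_≟ s) ∪? (_≟ c) ∪? Back? c)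
                (count-∪? (_≟ s) _ count-≡≤1 (count-∪? (_≟ c) _ count-≡≤1 count-Back≤1))
                cover
          where
          ¬Back-s : Long S y → ¬ Back s y
          ¬Back-s (y∈S , _) sy = ∄ (_ , y∈S , sy)

          cover : Long S y → Long (S ─ D′) y ⊎ y ≡ s ⊎ y ≡ c ⊎ Back c y
          cover l = Sum.map₂ (Sum.map₂ (Sum.map₂ Sum.[ ⊥-elim ∘ ¬Back-s l , proj₁ ])) (lost-shifted l)

    cheap≤3 : Delta122Free T → CheapTriangle 3 S
    cheap≤3 free with any? Arch?
    ... | no ∄ = t , cost≤3-unarched λ y arch → ∄ (y , arch)
    ... | yes (s , next , x , x∈S , x∉D , x<c , xs) with <-cmp x a
    ...   | tri< x<a _ _ = shifted x<a , cost≤3-shifted x<a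
      where open Arched free next x∈S x<c xs
    ...   | tri≈ _ x≡a _ = contradiction (x∈⁅a⁆∪⁅b⁆∪⁅c⁆⁺ (inj₁ x≡a)) x∉D
    ...   | tri> _ _ a<x = t , cost≤3-nested a<x
      where open Arched free next x∈S x<c xs

  open LeftmostLongTriangle public using (cost≤4; cheap≤3)

  Back⇒Between⊤ : Back x y → Between ⊤ x y
  Back⇒Between⊤ {x} {y} xy =
    fromℕ< 1+x<n , ∈⊤ , ≤-reflexive (sym (toℕ-fromℕ< 1+x<n)) ,
    subst (ℕ._< toℕ y) (sym (toℕ-fromℕ< 1+x<n)) 1+x<y
    where
    1+x<y : suc (toℕ x) ℕ.< toℕ y
    1+x<y = ℕ.≤∧≢⇒< (Back⇒< xy) λ 1+x≡y →
      contradiction (trans (sym (consecutive x y (sym 1+x≡y))) xy) λ ()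
    1+x<n : suc (toℕ x) ℕ.< n
    1+x<n = ℕ.<-trans 1+x<y (toℕ<n y)

  backIndicator : Fin n → Fin n → ℕ
  backIndicator y x = if back T σ y x then 1 else 0

  backDegree : Fin n → ℕ
  backDegree y = sum (map (backIndicator y) (allFin n))

  backDegree≤count : ∀ y → backDegree y ≤ count (λ x → Back? x y)
  backDegree≤count y = begin
    backDegree y                      ≡⟨ sum-map-allFin (backIndicator y) ⟩
    sum (tabulate (backIndicator y))  ≤⟨ sum-tabulate≤count (backIndicator y) (λ x → Back? x y)
                                           (indicator≤1 ∘ back T σ y) (indicator>0 ∘ back T σ y) ⟩
    count (λ x → Back? x y)           ∎
    where open ≤-Reasoning

  backDegree≤1 : ∀ y → backDegree y ≤ 1
  backDegree≤1 y = ≤-trans (backDegree≤count y) (count≤1 (λ x → Back? x y) Back-uniqueˡ)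

  backDegree>0⇒Long⊤ : ∀ y → 0 ℕ.< backDegree y → Long ⊤ y
  backDegree>0⇒Long⊤ y 0<deg with count>0⇒∃ (λ x → Back? x y) (ℕ.<-≤-trans 0<deg (backDegree≤count y))
  ... | x , xy = ∈⊤ , x , ∈⊤ , xy , Back⇒Between⊤ xy

  numBackEdges≤long⊤ : numBackEdges T σ ≤ long ⊤
  numBackEdges≤long⊤ = begin
    numBackEdges T σ           ≡⟨ sum-map-allFin backDegree ⟩
    sum (tabulate backDegree)  ≤⟨ sum-tabulate≤count backDegree (Long? ⊤)
                                    backDegree≤1 backDegree>0⇒Long⊤ ⟩
    long ⊤                     ∎
    where open ≤-Reasoning

  packing : Packing K ⊤ → Σ[ P ∈ List (Triple n) ] IsPacking T P × numBackEdges T σ ≤ K * length P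
  packing (P , isPacking , _ , bound) = P , isPacking , ≤-trans numBackEdges≤long⊤ bound

lemma7p2 : ∀ {n : ℕ} (T : Tournament n) (σ : Ordering n) → IsPaving T σ →
    (Σ (List (Triple n)) λ P → IsPacking T P × (numBackEdges T σ ≤ 4 * length P))
    × (Delta122Free T →
       Σ (List (Triple n)) λ P → IsPacking T P × (numBackEdges T σ ≤ 3 * length P))
lemma7p2 T σ paving =
  packing {K = 4} (greedy (λ t minimal → t , cost≤4 t minimal) ⊤) ,
  λ free → packing {K = 3} (greedy (λ t minimal → cheap≤3 t minimal free) ⊤)
  where open Paving T σ paving
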